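{- Let $G$ be a directed graph, let $\bar b$ be a finite tuple in $L(G)$, and let $c\in L(G)$. (1) There is an automorphism of $L(G)$ taking $\bar b$ to a tuple $\bar b'$ whose least element $b'$ satisfies $c<b'$ and such that the interval $(c,b')$ contains an element of length $2$. (2) There is an automorphism of $L(G)$ taking $\bar b$ to a tuple $\bar b''$ whose greatest element $b''$ satisfies $b''<c$ and such that the interval $(b'',c)$ contains an element of length $2$.
   Context: A directed graph is $G=(V,E)$ with $E$ binary and $V\subseteq\omega$. Fix an effective partition $(A_n)_{n\in\omega}$ of $\mathbb{Q}$ into pairwise disjoint dense sets, and an effective list $(t_m)_{1\le m<\omega}$ of all atomic types in $\{E\}$ of tuples of distinct elements, with $t_1$ the type of the empty tuple, then types of single elements, then of pairs, then triples, etc. $L(G)$ is the set of finite sequences of rationals $r_0q_1r_1\ldots r_{n-1}q_nr_nk$ ($n\ge0$) with $r_i\in A_0$ ($i<n$), $r_n\in A_1$, distinct $a_1,\dots,a_n\in V$ with $q_i\in A_{a_i}$ and $(a_1,\dots,a_n)$ realizing $t_m$ in $G$, and $k\in\omega$, $k<m$; ordered lexicographically. The length of an element is its length as a finite sequence. -}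

module Defs where

open import Data.Nat using (ℕ; zero; suc; _≤_) renaming (_<_ to _<ℕ_)
open import Data.Integer using (+_)
open import Data.Rational using (ℚ; _/_) renaming (_<_ to _<ℚ_)
open import Data.Bool using (Bool; true)
open import Data.Fin using (Fin)
import Data.Fin
open import Data.Vec using (Vec; lookup)
open import Data.List using (List; []; _∷_; length)
open import Data.List.Relation.Binary.Lex.Strict using (Lex-<)
open import Data.Product using (Σ; ∃; _×_; _,_; proj₁)
open import Relation.Binary.PropositionalEquality using (_≡_; _≢_)
open import Function.Bundles using (_⇔_)

record Graph : Set₁ where
  field
    V : ℕ → Set
    E : ℕ → ℕ → Set

-- Atomic type in {E} of an n-tuple of distinct elements:
-- the arity n and, for each (i,j), whether E(x_i,x_j) holds.
AtomicType : Set
AtomicType = Σ ℕ (λ n → Vec (Vec Bool n) n)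

arity : AtomicType → ℕ
arity = proj₁

-- The fixed effective data: a partition (A_n) of ℚ into pairwise disjoint
-- dense sets (given by the index function `part`, q ∈ A_n ⇔ part q ≡ n),
-- and an enumeration of all atomic types without repetition, by
-- nondecreasing arity.  `typ i` is t_{i+1} (the paper indexes from 1).
record Setup : Set where
  field
    part     : ℚ → ℕ
    dense    : ∀ n p q → p <ℚ q → ∃ λ r → p <ℚ r × r <ℚ q × part r ≡ n
    typ      : ℕ → AtomicType
    typ-inj  : ∀ i j → typ i ≡ typ j → i ≡ j
    typ-surj : ∀ τ → ∃ λ i → typ i ≡ τ
    typ-mono : ∀ i j → i ≤ j → arity (typ i) ≤ arity (typ j)

Realizes : Graph → (n : ℕ) → (Fin n → ℕ) → Vec (Vec Bool n) n → Set
Realizes G n a τ =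
  (∀ i → Graph.V G (a i)) ×
  (∀ i j → i ≢ j → a i ≢ a j) ×
  (∀ i j → (Graph.E G (a i) (a j) ⇔ (lookup (lookup τ i) j ≡ true)))

module _ (S : Setup) (G : Graph) where
  open Setup S

  -- The sequence r_0 q_1 r_1 … q_n r_n k, with k ∈ ω read as a rational.
  interleave : (n : ℕ) → (Fin (suc n) → ℚ) → (Fin n → ℚ) → ℕ → List ℚ
  interleave zero    r q k = r Data.Fin.zero ∷ ((+ k) / 1) ∷ []
  interleave (suc n) r q k =
    r Data.Fin.zero ∷ q Data.Fin.zero ∷
      interleave n (λ i → r (Data.Fin.suc i)) (λ i → q (Data.Fin.suc i)) k

  -- membership in L(G); m is the 0-based index, i.e. t_{m+1} = typ m,
  -- and the paper's condition k < m+1.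
  InL : List ℚ → Set
  InL x = Σ ℕ λ n → Σ (Fin (suc n) → ℚ) λ r → Σ (Fin n → ℚ) λ q →
          Σ (Fin n → ℕ) λ a → Σ ℕ λ m → Σ ℕ λ k →
            (x ≡ interleave n r q k) ×
            (∀ (i : Fin n) → part (r (Data.Fin.inject₁ i)) ≡ 0) ×
            (part (r (Data.Fin.fromℕ n)) ≡ 1) ×
            (∀ i → part (q i) ≡ a i) ×
            (Σ (Vec (Vec Bool n) n) λ τ → typ m ≡ (n , τ) × Realizes G n a τ) ×
            (k <ℕ suc m)

  LG : Set
  LG = Σ (List ℚ) InL

  _<L_ : LG → LG → Set
  x <L y = Lex-< _≡_ _<ℚ_ (proj₁ x) (proj₁ y)

  len : LG → ℕ
  len x = length (proj₁ x)

  -- an automorphism of (L(G), <): an order-preserving bijection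
  -- (elements are identified by their underlying sequences)
  record Aut : Set where
    field
      to       : LG → LG
      from     : LG → LG
      to-from  : ∀ y → proj₁ (to (from y)) ≡ proj₁ y
      from-to  : ∀ x → proj₁ (from (to x)) ≡ proj₁ x
      preserve : ∀ x y → (x <L y) ⇔ (to x <L to y)

module Submission where

-- Write first x for the leading rational r₀ of an
-- element x of L(G).  Elements of L(G) are compared lexicographically, so
-- first x < first y already forces x < y; and rewriting only r₀ by an order
-- automorphism of ℚ preserving the partition (A_n) (a "coloured
-- automorphism") is an automorphism of L(G).
--
-- Module ColouredRationals then proves homogeneity: whenever x₀ and z₀ lie
-- in the same A_n, some coloured automorphism sends x₀ to z₀.  This is the
-- back-and-forth argument along the enumeration of ℚ, with finite order-
-- and colour-preserving partial maps.
--
-- For the theorem, pick r ∈ A_1 above first c and let x₀ be the least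
-- leading rational in the tuple b.  Sending x₀ above r by a coloured
-- automorphism moves all of b above the length-2 element d = r 0, and
-- c < d.  The second half is the mirror image.

open import Data.Nat using (ℕ; zero; suc; z≤n; s≤s) renaming (_+_ to _+ℕ_)
open import Data.Nat.Properties using (+-suc; +-comm) renaming (+-identityʳ to n+0≡n)
open import Data.Integer using (ℤ; +_; -[1+_]; _⊖_)
open import Data.Rational using (ℚ; mkℚ; _/_; _<_; _≤_; 0ℚ; 1ℚ; -_; _<?_; _≟_)
import Data.Rational as ℚ
open import Data.Rational.Properties
  using (↥p/↧p≡p; <-cmp; <-irrefl; <-asym; <-trans; <⇒≤; ≤-refl; ≤-antisym; ≮⇒≥;
         <-≤-trans; ≤-<-trans; +-monoʳ-<; +-identityʳ; ≤-decTotalOrder; module ≤-Reasoning)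
open import Data.Fin using (Fin; inject₁; fromℕ) renaming (zero to fz; suc to fs)
open import Data.Vec using (Vec; lookup; [])
open import Data.Vec.Functional using (updateAt)
open import Data.List using (List; []; _∷_; [_]; map; filter; tabulate)
open import Data.List.Membership.Propositional using (_∈_; find; lose)
open import Data.List.Membership.Propositional.Properties
  using (∈-map⁺; ∈-map⁻; ∈-filter⁺; ∈-filter⁻; ∈-tabulate⁺)
open import Data.List.Relation.Unary.Any using (here; there; any?)
import Data.List.Relation.Unary.All as All
open import Data.List.Relation.Binary.Subset.Propositional using (_⊆_)
open import Data.List.Relation.Binary.Lex.Core using (base; halt; this; next)
open import Data.List.Relation.Binary.Lex.Strict using (Lex-<)
import Data.List.Extrema
open import Data.Product using (Σ; ∃; ∃₂; _×_; _,_; proj₁; proj₂; uncurry; swap; map₂)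
open import Data.Sum using ([_,_]′)
open import Data.Empty using (⊥-elim)
open import Relation.Nullary using (¬_; yes; no)
open import Relation.Nullary.Decidable using (toWitness)
open import Relation.Binary.Bundles using (DecTotalOrder)
open import Relation.Binary.Definitions using (tri<; tri≈; tri>)
open import Relation.Binary.PropositionalEquality
  using (_≡_; _≢_; refl; sym; trans; cong; subst; subst₂; module ≡-Reasoning)
open import Function using (_∘_; id)
open import Function.Bundles using (mk⇔)
open import Defs

-- Cantor's enumeration of ℕ × ℕ, one diagonal a + b = s after another.
nextPair : ℕ × ℕ → ℕ × ℕ
nextPair (a , zero)  = zero , suc a
nextPair (a , suc b) = suc a , b

unpair : ℕ → ℕ × ℕ
unpair zero    = zero , zero
unpair (suc k) = nextPair (unpair k)

unpair-onto : ∀ a b → ∃ λ k → unpair k ≡ (a , b)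
unpair-onto a b = onDiagonal (a +ℕ b) a b refl
  where
  onDiagonal : ∀ s a b → a +ℕ b ≡ s → ∃ λ k → unpair k ≡ (a , b)
  onDiagonal s (suc a) b eq with onDiagonal s a (suc b) (trans (+-suc a b) eq)
  ... | k , k↦ = suc k , cong nextPair k↦
  onDiagonal zero    zero zero      refl = zero , refl
  onDiagonal (suc s) zero .(suc s) refl with onDiagonal s s zero (n+0≡n s)
  ... | k , k↦ = suc k , cong nextPair k↦

enumℤ : ℕ → ℤ
enumℤ k = uncurry _⊖_ (unpair k)

enumℤ-onto : ∀ z → ∃ λ k → enumℤ k ≡ z
enumℤ-onto (+ n)    = map₂ (cong (uncurry _⊖_)) (unpair-onto n zero)
enumℤ-onto -[1+ n ] = map₂ (cong (uncurry _⊖_)) (unpair-onto zero (suc n))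

fraction : ℕ × ℕ → ℚ
fraction (i , d) = enumℤ i / suc d

enumℚ : ℕ → ℚ
enumℚ k = fraction (unpair k)

enumℚ-onto : ∀ q → ∃ λ k → enumℚ k ≡ q
enumℚ-onto q@(mkℚ n d _) with enumℤ-onto n
... | i , i↦n with unpair-onto i d
... | k , k↦id = k , (begin
  fraction (unpair k) ≡⟨ cong fraction k↦id ⟩
  enumℤ i / suc d     ≡⟨ cong (_/ suc d) i↦n ⟩
  n / suc d           ≡⟨ ↥p/↧p≡p q ⟩
  q                   ∎)
  where open ≡-Reasoning

0<1 : 0ℚ < 1ℚ
0<1 = toWitness {a? = 0ℚ <? 1ℚ} _

-1<0 : - 1ℚ < 0ℚ
-1<0 = toWitness {a? = - 1ℚ <? 0ℚ} _

p<p+1 : ∀ p → p < p ℚ.+ 1ℚ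
p<p+1 p = subst (_< p ℚ.+ 1ℚ) (+-identityʳ p) (+-monoʳ-< p 0<1)

p-1<p : ∀ p → p ℚ.- 1ℚ < p
p-1<p p = subst (p ℚ.- 1ℚ <_) (+-identityʳ p) (+-monoʳ-< p -1<0)

≮∧≯⇒≡ : ∀ {p q} → ¬ p < q → ¬ q < p → p ≡ q
≮∧≯⇒≡ p≮q q≮p = ≤-antisym (≮⇒≥ q≮p) (≮⇒≥ p≮q)

module Extrema = Data.List.Extrema (DecTotalOrder.totalOrder ≤-decTotalOrder)
open Extrema using (max; min)

max∈ : ∀ l L → max l L ∈ l ∷ L
max∈ l L = [ here , there ]′ (Extrema.argmax-sel id l L)

min∈ : ∀ u U → min u U ∈ u ∷ U
min∈ u U = [ here , there ]′ (Extrema.argmin-sel id u U)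

≤max : ∀ l L {v} → v ∈ l ∷ L → v ≤ max l L
≤max l L (here refl) = Extrema.⊥≤max l L
≤max l L (there v∈) = All.lookup (Extrema.xs≤max l L) v∈

min≤ : ∀ u U {v} → v ∈ u ∷ U → min u U ≤ v
min≤ u U (here refl) = Extrema.min≤⊤ u U
min≤ u U (there v∈) = All.lookup (Extrema.min≤xs u U) v∈

least greatest : ∀ {n} → (Fin (suc n) → ℚ) → ℚ
least    h = min (h fz) (tabulate h)
greatest h = max (h fz) (tabulate h)

least≤ : ∀ {n} (h : Fin (suc n) → ℚ) i → least h ≤ h i
least≤ h i = All.lookup (Extrema.min≤xs (h fz) (tabulate h)) (∈-tabulate⁺ {f = h} i)

≤greatest : ∀ {n} (h : Fin (suc n) → ℚ) i → h i ≤ greatest h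
≤greatest h i = All.lookup (Extrema.xs≤max (h fz) (tabulate h)) (∈-tabulate⁺ {f = h} i)

separating-interval : (L U : List ℚ) → (∀ {l u} → l ∈ L → u ∈ U → l < u) →
  ∃₂ λ p q → p < q × (∀ {l} → l ∈ L → l ≤ p) × (∀ {u} → u ∈ U → q ≤ u)
separating-interval []      []      _   = 0ℚ , 1ℚ , 0<1 , (λ ()) , (λ ())
separating-interval []      (u ∷ U) _   =
  min u U ℚ.- 1ℚ , min u U , p-1<p _ , (λ ()) , min≤ u U
separating-interval (l ∷ L) []      _   =
  max l L , max l L ℚ.+ 1ℚ , p<p+1 _ , ≤max l L , (λ ())
separating-interval (l ∷ L) (u ∷ U) L<U =
  max l L , min u U , L<U (max∈ l L) (min∈ u U) , ≤max l L , min≤ u U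

Increasing : (ℚ → ℚ) → Set
Increasing f = ∀ {p q} → p < q → f p < f q

increasing⇒monotone : ∀ {f} → Increasing f → ∀ {p q} → p ≤ q → f p ≤ f q
increasing⇒monotone f↑ {p} {q} p≤q with <-cmp p q
... | tri< p<q _ _ = <⇒≤ (f↑ p<q)
... | tri≈ _ refl _ = ≤-refl
... | tri> _ _ q<p = ⊥-elim (<-irrefl refl (<-≤-trans q<p p≤q))

inverse-increasing : ∀ {f g} → Increasing f → (∀ q → f (g q) ≡ q) → Increasing g
inverse-increasing {f} {g} f↑ fg {p} {q} p<q with <-cmp (g p) (g q)
... | tri< gp<gq _ _ = gp<gq
... | tri≈ _ gp≡gq _ =
  ⊥-elim (<-irrefl (trans (sym (fg p)) (trans (cong f gp≡gq) (fg q))) p<q)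
... | tri> _ _ gq<gp = ⊥-elim (<-asym p<q (subst₂ _<_ (fg q) (fg p) (f↑ gq<gp)))

record ColouredAuto (colour : ℚ → ℕ) : Set where
  field
    to from       : ℚ → ℚ
    to-increasing : Increasing to
    to-from       : ∀ q → to (from q) ≡ q
    from-to       : ∀ q → from (to q) ≡ q
    to-colour     : ∀ q → colour (to q) ≡ colour q

  from-increasing : Increasing from
  from-increasing = inverse-increasing to-increasing to-from

  from-colour : ∀ q → colour (from q) ≡ colour q
  from-colour q = trans (sym (to-colour (from q))) (cong colour (to-from q))

module ColouredRationals (colour : ℚ → ℕ)
  (dense : ∀ n p q → p < q → ∃ λ r → p < r × r < q × colour r ≡ n) where

  colour-above : ∀ n p → ∃ λ r → p < r × colour r ≡ n
  colour-above n p with dense n p (p ℚ.+ 1ℚ) (p<p+1 p)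
  ... | r , p<r , _ , r-colour = r , p<r , r-colour

  colour-below : ∀ n p → ∃ λ r → r < p × colour r ≡ n
  colour-below n p with dense n (p ℚ.- 1ℚ) p (p-1<p p)
  ... | r , _ , r<p , r-colour = r , r<p , r-colour

  -- A finite partial map on ℚ, listed as its pairs (x , y), x ↦ y.
  PMap : Set
  PMap = List (ℚ × ℚ)

  Compatible : ℚ × ℚ → ℚ × ℚ → Set
  Compatible (x , y) (x' , y') = (x < x' → y < y') × (y < y' → x < x')

  compatible-refl : ∀ p → Compatible p p
  compatible-refl _ = (λ p<p → ⊥-elim (<-irrefl refl p<p)) , (λ p<p → ⊥-elim (<-irrefl refl p<p))

  reflect-by-trichotomy : ∀ {a b x y} → x ≢ a → (x < a → y < b) → b < y → a < x
  reflect-by-trichotomy {a} {x = x} x≢a below b<y with <-cmp a x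
  ... | tri< a<x _ _ = a<x
  ... | tri≈ _ a≡x _ = ⊥-elim (x≢a (sym a≡x))
  ... | tri> _ _ x<a = ⊥-elim (<-asym b<y (below x<a))

  record IsPartialIso (P : PMap) : Set where
    field
      preserves-colour : ∀ {x y} → (x , y) ∈ P → colour x ≡ colour y
      compatible       : ∀ {p p'} → p ∈ P → p' ∈ P → Compatible p p'
  open IsPartialIso

  invert : ℚ × ℚ → ℚ × ℚ
  invert = swap

  invert⁻ : ∀ {P p} → p ∈ map invert P → invert p ∈ P
  invert⁻ p∈ with ∈-map⁻ invert p∈
  ... | _ , p'∈ , refl = p'∈

  invert-iso : ∀ {P} → IsPartialIso P → IsPartialIso (map invert P)
  invert-iso iso = record
    { preserves-colour = λ p∈ → sym (preserves-colour iso (invert⁻ p∈))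
    ; compatible       = λ p∈ p'∈ → swap (compatible iso (invert⁻ p∈) (invert⁻ p'∈))
    }

  images-below images-above : PMap → ℚ → List ℚ
  images-below P a = map proj₂ (filter (λ p → proj₁ p <? a) P)
  images-above P a = map proj₂ (filter (λ p → a <? proj₁ p) P)

  below⁺ : ∀ {P a x y} → (x , y) ∈ P → x < a → y ∈ images-below P a
  below⁺ {a = a} m x<a = ∈-map⁺ proj₂ (∈-filter⁺ (λ p → proj₁ p <? a) m x<a)

  above⁺ : ∀ {P a x y} → (x , y) ∈ P → a < x → y ∈ images-above P a
  above⁺ {a = a} m a<x = ∈-map⁺ proj₂ (∈-filter⁺ (λ p → a <? proj₁ p) m a<x)

  below⁻ : ∀ {P a y} → y ∈ images-below P a → ∃ λ x → (x , y) ∈ P × x < a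
  below⁻ {P} {a} y∈ with ∈-map⁻ proj₂ y∈
  ... | (x , _) , m , refl = x , ∈-filter⁻ (λ p → proj₁ p <? a) {xs = P} m

  above⁻ : ∀ {P a y} → y ∈ images-above P a → ∃ λ x → (x , y) ∈ P × a < x
  above⁻ {P} {a} y∈ with ∈-map⁻ proj₂ y∈
  ... | (x , _) , m , refl = x , ∈-filter⁻ (λ p → a <? proj₁ p) {xs = P} m

  below<above : ∀ {P a l u} → IsPartialIso P →
    l ∈ images-below P a → u ∈ images-above P a → l < u
  below<above iso l∈ u∈ with below⁻ l∈ | above⁻ u∈
  ... | _ , m , x<a | _ , m' , a<x' = proj₁ (compatible iso m m') (<-trans x<a a<x')

  fresh-image : ∀ {P} → IsPartialIso P → ∀ a → ∃ λ b → colour b ≡ colour a ×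
    (∀ {x y} → (x , y) ∈ P → (x < a → y < b) × (a < x → b < y))
  fresh-image {P} iso a
    with separating-interval (images-below P a) (images-above P a) (below<above iso)
  ... | p , q , p<q , below≤p , q≤above with dense (colour a) p q p<q
  ... | b , p<b , b<q , b-colour = b , b-colour , λ m →
    (λ x<a → ≤-<-trans (below≤p (below⁺ m x<a)) p<b) ,
    (λ a<x → <-≤-trans b<q (q≤above (above⁺ m a<x)))

  add-fresh : ∀ {P} → IsPartialIso P → ∀ a → (∀ {x y} → (x , y) ∈ P → x ≢ a) →
    ∃ λ b → IsPartialIso ((a , b) ∷ P)
  add-fresh {P} iso a fresh with fresh-image iso a
  ... | b , b-colour , placed = b , record
    { preserves-colour = λ { (here refl) → sym b-colour ; (there m) → preserves-colour iso m }
    ; compatible       = compatible′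
    }
    where
    compatible′ : ∀ {p p'} → p ∈ (a , b) ∷ P → p' ∈ (a , b) ∷ P → Compatible p p'
    compatible′ (here refl) (here refl) = compatible-refl (a , b)
    compatible′ (here refl) (there m)   =
      proj₂ (placed m) , reflect-by-trichotomy (fresh m) (proj₁ (placed m))
    compatible′ (there m)   (here refl) =
      proj₁ (placed m) , reflect-by-trichotomy (fresh m ∘ sym) (proj₂ (placed m))
    compatible′ (there m)   (there m')  = compatible iso m m'

  record Extension (P : PMap) (Goal : PMap → Set) : Set where
    field
      table   : PMap
      iso     : IsPartialIso table
      extends : P ⊆ table
      goal    : Goal table

  Defined Attained : ℚ → PMap → Set
  Defined  a Q = ∃ λ b → (a , b) ∈ Q
  Attained b Q = ∃ λ a → (a , b) ∈ Q

  forth : ∀ {P} → IsPartialIso P → ∀ a → Extension P (Defined a)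
  forth {P} iso a with any? (λ p → proj₁ p ≟ a) P
  ... | yes found with find found
  ...   | (_ , b) , m , refl = record { table = P ; iso = iso ; extends = id ; goal = b , m }
  forth {P} iso a | no absent with add-fresh iso a (λ m x≡a → absent (lose m x≡a))
  ... | b , iso′ = record { table = (a , b) ∷ P ; iso = iso′ ; extends = there ; goal = b , here refl }

  -- Back: put b into the range, by going forth for the inverse map.
  back : ∀ {P} → IsPartialIso P → ∀ b → Extension P (Attained b)
  back iso b = record
    { table   = map invert table
    ; iso     = invert-iso iso′
    ; extends = ∈-map⁺ invert ∘ extends ∘ ∈-map⁺ invert
    ; goal    = map₂ (∈-map⁺ invert) goal
    }
    where open Extension (forth (invert-iso iso) b) renaming (iso to iso′)

  round : ∀ {P} → IsPartialIso P → ∀ a → Extension P (λ Q → Defined a Q × Attained a Q)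
  round {P} iso a = record
    { table   = Extension.table backward
    ; iso     = Extension.iso backward
    ; extends = Extension.extends backward ∘ Extension.extends forward
    ; goal    = map₂ (Extension.extends backward) (Extension.goal forward) , Extension.goal backward
    }
    where
    forward : Extension P (Defined a)
    forward = forth iso a

    backward : Extension (Extension.table forward) (Attained a)
    backward = back (Extension.iso forward) a

  -- The union of the chain of rounds along the enumeration of ℚ, started
  -- from x₀ ↦ z₀, is a coloured automorphism sending x₀ to z₀.
  module Construction (x₀ z₀ : ℚ) (same-colour : colour x₀ ≡ colour z₀) where

    initial : IsPartialIso [ x₀ , z₀ ]
    initial = record
      { preserves-colour = λ { (here refl) → same-colour ; (there ()) }
      ; compatible       = λ { (here refl) (here refl) → compatible-refl (x₀ , z₀)
                             ; (here _) (there ()) ; (there ()) _ }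
      }

    stage : ℕ → Σ PMap IsPartialIso
    round-at : ∀ s → Extension (proj₁ (stage s)) (λ Q → Defined (enumℚ s) Q × Attained (enumℚ s) Q)
    stage zero    = [ x₀ , z₀ ] , initial
    stage (suc s) = Extension.table (round-at s) , Extension.iso (round-at s)
    round-at s = round (proj₂ (stage s)) (enumℚ s)

    table : ℕ → PMap
    table s = proj₁ (stage s)

    -- The stages form an increasing chain, so any two of its pairs are
    -- compatible, lying in a common stage.
    grows : ∀ k s → table s ⊆ table (k +ℕ s)
    grows zero    s m = m
    grows (suc k) s m = Extension.extends (round-at (k +ℕ s)) (grows k s m)

    compatible-union : ∀ s t {p p'} → p ∈ table s → p' ∈ table t → Compatible p p'
    compatible-union s t {p' = p'} m m' = compatible (proj₂ (stage (t +ℕ s)))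
      (grows t s m) (subst (λ u → p' ∈ table u) (+-comm s t) (grows s t m'))

    functional : ∀ s t {x y y'} → (x , y) ∈ table s → (x , y') ∈ table t → y ≡ y'
    functional s t m m' = ≮∧≯⇒≡
      (λ y<y' → <-irrefl refl (proj₂ (compatible-union s t m m') y<y'))
      (λ y'<y → <-irrefl refl (proj₂ (compatible-union t s m' m) y'<y))

    injective : ∀ s t {x x' y} → (x , y) ∈ table s → (x' , y) ∈ table t → x ≡ x'
    injective s t m m' = ≮∧≯⇒≡
      (λ x<x' → <-irrefl refl (proj₁ (compatible-union s t m m') x<x'))
      (λ x'<x → <-irrefl refl (proj₁ (compatible-union t s m' m) x'<x))

    entered : ∀ q → ∃ λ s → Defined q (table s) × Attained q (table s)
    entered q with enumℚ-onto q
    ... | k , refl = suc k , Extension.goal (round-at k)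

    entry : ℚ → ℕ
    entry q = proj₁ (entered q)

    to from : ℚ → ℚ
    to   q = proj₁ (proj₁ (proj₂ (entered q)))
    from q = proj₁ (proj₂ (proj₂ (entered q)))

    to∈ : ∀ q → (q , to q) ∈ table (entry q)
    to∈ q = proj₂ (proj₁ (proj₂ (entered q)))

    from∈ : ∀ q → (from q , q) ∈ table (entry q)
    from∈ q = proj₂ (proj₂ (proj₂ (entered q)))

    automorphism : ColouredAuto colour
    automorphism = record
      { to            = to
      ; from          = from
      ; to-increasing = λ {p} {q} → proj₁ (compatible-union (entry p) (entry q) (to∈ p) (to∈ q))
      ; to-from       = λ q → functional (entry (from q)) (entry q) (to∈ (from q)) (from∈ q)
      ; from-to       = λ q → injective (entry (to q)) (entry q) (from∈ (to q)) (to∈ q)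
      ; to-colour     = λ q → sym (preserves-colour (proj₂ (stage (entry q))) (to∈ q))
      }

    sends-x₀ : to x₀ ≡ z₀
    sends-x₀ = functional (entry x₀) 0 (to∈ x₀) (here refl)

  transfer : ∀ x₀ z₀ → colour x₀ ≡ colour z₀ →
    Σ (ColouredAuto colour) λ α → ColouredAuto.to α x₀ ≡ z₀
  transfer x₀ z₀ same-colour = automorphism , sends-x₀
    where open Construction x₀ z₀ same-colour

onHead : (ℚ → ℚ) → List ℚ → List ℚ
onHead h []       = []
onHead h (x ∷ xs) = h x ∷ xs

onHead-inverse : ∀ {f g} → (∀ q → g (f q) ≡ q) → ∀ xs → onHead g (onHead f xs) ≡ xs
onHead-inverse gf []       = refl
onHead-inverse gf (x ∷ xs) = cong (_∷ xs) (gf x)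

onHead-lex : ∀ {h} → Increasing h → ∀ {xs ys} →
  Lex-< _≡_ _<_ xs ys → Lex-< _≡_ _<_ (onHead h xs) (onHead h ys)
onHead-lex h↑ (base ())
onHead-lex h↑ halt             = halt
onHead-lex h↑ (this x<y)       = this (h↑ x<y)
onHead-lex h↑ (next refl rest) = next refl rest

module LG-Automorphisms (S : Setup) (G : Graph) where
  open Setup S
  open ColouredRationals part dense using (colour-above; colour-below; transfer)

  onHead-interleave : ∀ h n r q k →
    onHead h (interleave S G n r q k) ≡ interleave S G n (updateAt r fz h) q k
  onHead-interleave h zero    r q k = refl
  onHead-interleave h (suc n) r q k = refl

  onHead-InL : ∀ h → (∀ q → part (h q) ≡ part q) → ∀ {x} → InL S G x → InL S G (onHead h x)
  onHead-InL h h-colour (n , r , q , a , m , k , refl , r-body , r-last , rest) =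
    n , updateAt r fz h , q , a , m , k , onHead-interleave h n r q k ,
    (λ i → trans (same-colour (inject₁ i)) (r-body i)) ,
    trans (same-colour (fromℕ n)) r-last , rest
    where
    same-colour : ∀ i → part (updateAt r fz h i) ≡ part (r i)
    same-colour fz     = h-colour (r fz)
    same-colour (fs i) = refl

  lift : ColouredAuto part → Aut S G
  lift α = record
    { to       = λ x → onHead to (proj₁ x) , onHead-InL to to-colour (proj₂ x)
    ; from     = λ x → onHead from (proj₁ x) , onHead-InL from from-colour (proj₂ x)
    ; to-from  = λ y → onHead-inverse to-from (proj₁ y)
    ; from-to  = λ x → onHead-inverse from-to (proj₁ x)
    ; preserve = λ x y → mk⇔ (onHead-lex to-increasing) λ moved →
        subst₂ (Lex-< _≡_ _<_) (onHead-inverse from-to (proj₁ x)) (onHead-inverse from-to (proj₁ y))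
          (onHead-lex from-increasing moved)
    }
    where open ColouredAuto α

  first : LG S G → ℚ
  first (_ , _ , r , _) = r fz

  interleave-∷ : ∀ n r q k → ∃ λ t → interleave S G n r q k ≡ r fz ∷ t
  interleave-∷ zero    r q k = _ , refl
  interleave-∷ (suc n) r q k = _ , refl

  first-<L : ∀ x y → first x < first y → _<L_ S G x y
  first-<L (_ , n , r , q , _ , _ , k , refl , _) (_ , n' , r' , q' , _ , _ , k' , refl , _) r₀<r₀'
    rewrite proj₂ (interleave-∷ n r q k) | proj₂ (interleave-∷ n' r' q' k') = this r₀<r₀'

  first-lift : ∀ α x → first (Aut.to (lift α) x) ≡ ColouredAuto.to α (first x)
  first-lift α (_ , n , r , q , a , m , k , refl , _) = refl

  -- The element r 0 of length 2 (n = 0, k = 0, empty type), for r ∈ A_1.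
  short : ∀ r → part r ≡ 1 → LG S G
  short r r∈A₁ = (r ∷ + 0 / 1 ∷ []) ,
    0 , (λ _ → r) , (λ ()) , (λ ()) , empty-type , 0 , refl , (λ ()) , r∈A₁ , (λ ()) ,
    ([] , proj₂ (typ-surj (0 , [])) , (λ ()) , (λ ()) , (λ ())) , s≤s z≤n
    where
    empty-type : ℕ
    empty-type = proj₁ (typ-surj (0 , []))

  above-image : ∀ {n} (b : Fin (suc n) → LG S G) (α : ColouredAuto part) {z} →
    ColouredAuto.to α (least (first ∘ b)) ≡ z → ∀ i → z ≤ first (Aut.to (lift α) (b i))
  above-image b α {z} α[x₀]≡z i = begin
    z                               ≡⟨ sym α[x₀]≡z ⟩
    to (least (first ∘ b))          ≤⟨ increasing⇒monotone to-increasing (least≤ (first ∘ b) i) ⟩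
    to (first (b i))                ≡⟨ sym (first-lift α (b i)) ⟩
    first (Aut.to (lift α) (b i))   ∎
    where open ColouredAuto α
          open ≤-Reasoning

  below-image : ∀ {n} (b : Fin (suc n) → LG S G) (α : ColouredAuto part) {z} →
    ColouredAuto.to α (greatest (first ∘ b)) ≡ z → ∀ i → first (Aut.to (lift α) (b i)) ≤ z
  below-image b α {z} α[x₀]≡z i = begin
    first (Aut.to (lift α) (b i))   ≡⟨ first-lift α (b i) ⟩
    to (first (b i))                ≤⟨ increasing⇒monotone to-increasing (≤greatest (first ∘ b) i) ⟩
    to (greatest (first ∘ b))       ≡⟨ α[x₀]≡z ⟩
    z                               ∎
    where open ColouredAuto α
          open ≤-Reasoning

  push-above : ∀ {n} (b : Fin (suc n) → LG S G) p →
    Σ (Aut S G) λ σ → ∀ i → p < first (Aut.to σ (b i))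
  push-above b p =
    let x₀                = least (first ∘ b)
        z , p<z , z-colour = colour-above (part x₀) p
        α , α[x₀]≡z       = transfer x₀ z (sym z-colour)
    in lift α , λ i → <-≤-trans p<z (above-image b α α[x₀]≡z i)

  push-below : ∀ {n} (b : Fin (suc n) → LG S G) p →
    Σ (Aut S G) λ σ → ∀ i → first (Aut.to σ (b i)) < p
  push-below b p =
    let x₀                = greatest (first ∘ b)
        z , z<p , z-colour = colour-below (part x₀) p
        α , α[x₀]≡z       = transfer x₀ z (sym z-colour)
    in lift α , λ i → ≤-<-trans (below-image b α α[x₀]≡z i) z<p

-- Lemma 3.9: take r ∈ A_1 on the far side of first c, move b beyond r, and
-- separate b from c by the length-2 element r 0.
lemma3p9 : (S : Setup) (G : Graph) (n : ℕ) (b : Vec (LG S G) (suc n)) (c : LG S G) →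
    (Σ (Aut S G) λ σ → ∃ λ d →
        len S G d ≡ 2 × _<L_ S G c d ×
        (∀ i → _<L_ S G d (Aut.to σ (lookup b i))))
    ×
    (Σ (Aut S G) λ σ → ∃ λ d →
        len S G d ≡ 2 × _<L_ S G d c ×
        (∀ i → _<L_ S G (Aut.to σ (lookup b i)) d))
lemma3p9 S G n b c =
  (let r , c<r , r∈A₁ = colour-above 1 (first c)
       σ , r<b       = push-above (lookup b) r
       d             = short r r∈A₁
   in σ , d , refl , first-<L c d c<r , λ i → first-<L d (Aut.to σ (lookup b i)) (r<b i))
  ,
  (let r , r<c , r∈A₁ = colour-below 1 (first c)
       σ , b<r       = push-below (lookup b) r
       d             = short r r∈A₁
   in σ , d , refl , first-<L d c r<c , λ i → first-<L (Aut.to σ (lookup b i)) d (b<r i))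
  where
  open Setup S
  open ColouredRationals part dense using (colour-above; colour-below)
  open LG-Automorphisms S G
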